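{- Let $c=(c(n))_{n\ge0}$ be a sequence in $\mathcal{R}=\mathbb{Q}[[q]]$ with $v(c(n))\ge n$ for all $n\in\mathbb{N}$. Then the following equality holds in $\mathbb{Q}[[q,z]]$: \[ f_c(z)=c(0)+\sum_{m=1}^{\infty}\Bigl(\sum_{n=1}^{\infty}c(n)\,a_{z_1^m}(n-1)\Bigr)\Bigl(\frac{z-1}{1-q}\Bigr)^{m}. \]
   Context: For $f=\sum_j c_jq^j\in\mathbb{Q}[[q]]$, $v(f)=\inf\{j:c_j\neq0\}$. On $\mathbb{Q}[[q,z]]$ use the valuation $v(\sum c_{ij}q^iz^j)=\inf\{i+j:c_{ij}\ne0\}$ and the associated topology, in which infinite sums are understood. Let $(x)_n=\prod_{j=0}^{n-1}(1-xq^j)$, $B_0(z)=1$, $B_n(z)=\prod_{j=1}^{n}\frac{z-q^{j-1}}{1-q^j}$ ($n\ge1$), and $f_c(z)=\sum_{n\ge0}c(n)B_n(z)$ (convergent under the stated valuation hypothesis). Let $[m]=(1-q^m)/(1-q)$. For $m\ge1$ and $k\ge0$, $a_{z_1^m}(k)=\sum_{k+1=m_1>m_2>\dots>m_m>0}\frac{1}{[m_1][m_2]\cdots[m_m]}$ (the sum over strictly decreasing $m$-tuples of positive integers with first entry $k+1$). -}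

module Defs where

open import Data.Nat using (ℕ; zero; suc; _∸_; _≡ᵇ_; _<_; _≤_) renaming (_+_ to _+ℕ_)
open import Data.Nat.DivMod using (_%_)
open import Data.Bool using (if_then_else_)
open import Data.Rational using (ℚ; 0ℚ; 1ℚ; _+_; _*_; -_)
open import Data.List using (List; []; _∷_; map; concatMap; foldr; upTo)
open import Relation.Binary.PropositionalEquality using (_≡_)
open import Data.Product using (∃)

sumTo : ℕ → (ℕ → ℚ) → ℚ
sumTo zero    f = f 0
sumTo (suc n) f = sumTo n f + f (suc n)

-- ℚ[[q]] : a series is its coefficient function  i ↦ [q^i] f
PS : Set
PS = ℕ → ℚ

zeroₚ oneₚ : PS
zeroₚ _ = 0ℚ
oneₚ i = if i ≡ᵇ 0 then 1ℚ else 0ℚ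

_+ₚ_ : PS → PS → PS
(f +ₚ g) i = f i + g i

_*ₚ_ : PS → PS → PS
(f *ₚ g) n = sumTo n (λ k → f k * g (n ∸ k))

oneMinusQ : PS
oneMinusQ i = if i ≡ᵇ 0 then 1ℚ else (if i ≡ᵇ 1 then - 1ℚ else 0ℚ)

-- geomInv j = 1/(1 - q^(j+1)) = Σ_k q^((j+1)k)
geomInv : ℕ → PS
geomInv j i = if (i % suc j) ≡ᵇ 0 then 1ℚ else 0ℚ

-- invQint t = 1/[t+1] = (1-q)/(1-q^(t+1))
invQint : ℕ → PS
invQint t = oneMinusQ *ₚ geomInv t

-- 1/[t] for a positive integer t (value irrelevant at t = 0, never used)
invBracket : ℕ → PS
invBracket zero    = zeroₚ
invBracket (suc t) = invQint t

-- strictly decreasing lists of length m with all entries in {1,…,b}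
dec : ℕ → ℕ → List (List ℕ)
dec zero    b = [] ∷ []
dec (suc m) b = concatMap (λ s → map (suc s ∷_) (dec m s)) (upTo b)

sumListₚ : List PS → PS
sumListₚ = foldr _+ₚ_ zeroₚ

prodListₚ : List PS → PS
prodListₚ = foldr _*ₚ_ oneₚ

-- aZ m k = a_{z_1^m}(k) = Σ_{k+1 = m_1 > m_2 > … > m_m > 0} 1/([m_1]⋯[m_m])   (m ≥ 1)
-- (aZ 0 k = 0 is a dummy value; the paper only uses m ≥ 1)
aZ : ℕ → ℕ → PS
aZ zero    k = zeroₚ
aZ (suc m) k = sumListₚ (map (λ t → prodListₚ (map invBracket t)) (map (suc k ∷_) (dec m k)))

-- ℚ[[q,z]] : coefficient function  (i , j) ↦ [q^i z^j] F
PS2 : Set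
PS2 = ℕ → ℕ → ℚ

one₂ : PS2
one₂ i j = if i ≡ᵇ 0 then (if j ≡ᵇ 0 then 1ℚ else 0ℚ) else 0ℚ

_+₂_ : PS2 → PS2 → PS2
(F +₂ G) i j = F i j + G i j

_*₂_ : PS2 → PS2 → PS2
(F *₂ G) i j = sumTo i (λ a → sumTo j (λ b → F a b * G (i ∸ a) (j ∸ b)))

embed : PS → PS2
embed f i j = if j ≡ᵇ 0 then f i else 0ℚ

zVar : PS2
zVar i j = if i ≡ᵇ 0 then (if j ≡ᵇ 1 then 1ℚ else 0ℚ) else 0ℚ

qPow : ℕ → PS
qPow n i = if i ≡ᵇ n then 1ℚ else 0ℚ

neg₂ : PS2 → PS2
neg₂ F i j = - F i j

pow₂ : PS2 → ℕ → PS2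
pow₂ F zero    = one₂
pow₂ F (suc m) = pow₂ F m *₂ F

-- B_n(z) = ∏_{j=1}^{n} (z - q^{j-1}) / (1 - q^j)
B : ℕ → PS2
B zero    = one₂
B (suc n) = B n *₂ ((zVar +₂ neg₂ (embed (qPow n))) *₂ embed (geomInv n))

w : PS2
w = (zVar +₂ neg₂ one₂) *₂ embed (geomInv 0)

-- Convergence of infinite sums in the valuation topologies.
-- HasSum F S :  v(S - Σ_{n=0}^{M} F n) → ∞  as M → ∞, i.e.
-- for every d there is N with v(S - Σ_{n≤M} F n) ≥ d for all M ≥ N.
HasSum₁ : (ℕ → PS) → PS → Set
HasSum₁ F S = ∀ d → ∃ λ N → ∀ M → N ≤ M → ∀ i → i < d →
  sumTo M (λ n → F n i) ≡ S i

HasSum₂ : (ℕ → PS2) → PS2 → Set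
HasSum₂ F S = ∀ d → ∃ λ N → ∀ M → N ≤ M → ∀ i j → i +ℕ j < d →
  sumTo M (λ n → F n i j) ≡ S i j

module Submission where

-- Since z - q^{k+1} = (z-1) + (1-q^{k+1}), the factors of B satisfy
--   (1/[k+1]) · (z - q^{k+1})/(1 - q^{k+2}) = (1/[k+2]) · (1 + W/[k+1]),
-- so by induction  B_{k+1} = (W/[k+1]) ∏_{t≤k} (1 + W/[t]).  Expanding the product by
-- the elementary symmetric functions e_m of 1/[1],…,1/[k], and noting that
-- a_{z₁^{m+1}}(k) = e_m(1/[1],…,1/[k])/[k+1], gives  B_{k+1} = Σ_{m≤k} a_{z₁^{m+1}}(k) W^{m+1}.
-- Summing against c and exchanging two finite sums proves the identity for every
-- truncation c(0),…,c(M+1).  As v(c(n)) ≥ n, the coefficient of qⁱ of every series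
-- involved only sees the terms of index ≤ i: all series converge, and the
-- truncation at M = i computes the coefficient of qⁱ.

open import Data.Nat using (ℕ; zero; suc; _∸_; _≤_; _<_; _<?_; z≤n; s≤s; _≡ᵇ_)
import Data.Nat.Properties as ℕₚ
open import Data.Nat.DivMod using (m<n⇒m%n≡m; m≤n⇒[n∸m]%m≡n%m)
open import Data.Bool using (true; false; if_then_else_)
open import Data.Empty using (⊥-elim)
open import Data.Sum using (inj₁; inj₂)
open import Data.Product using (Σ-syntax; _×_; _,_)
open import Data.List using (List; []; _∷_; _++_; map; upTo; concatMap; [_])
import Data.List.Properties as Listₚ
open import Data.Rational using (0ℚ; 1ℚ) renaming (_+_ to _ℚ+_; _*_ to _ℚ*_; -_ to ℚ-_)
import Data.Rational.Properties as ℚₚ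
open import Relation.Binary.PropositionalEquality using (_≡_; _≢_)
import Relation.Binary.PropositionalEquality as ≡
open import Relation.Nullary using (yes; no)
open import Algebra.Bundles using (CommutativeRing)
import Algebra.Construct.Pointwise ℕ as Pointwise
open import Defs

module FiniteSums {c ℓ} (R : CommutativeRing c ℓ) where
  open CommutativeRing R
  open import Relation.Binary.Reasoning.Setoid setoid
  open import Algebra.Solver.Ring.NaturalCoefficients.Default commutativeSemiring
    using (solve; _:+_; _:=_)

  ∑ : ℕ → (ℕ → Carrier) → Carrier
  ∑ zero    f = f 0
  ∑ (suc n) f = ∑ n f + f (suc n)

  ∑-cong : ∀ n {f g} → (∀ k → k ≤ n → f k ≈ g k) → ∑ n f ≈ ∑ n g
  ∑-cong zero    f≈g = f≈g 0 z≤n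
  ∑-cong (suc n) f≈g =
    +-cong (∑-cong n (λ k k≤n → f≈g k (ℕₚ.m≤n⇒m≤1+n k≤n))) (f≈g (suc n) ℕₚ.≤-refl)

  ∑-zero : ∀ n f → (∀ k → k ≤ n → f k ≈ 0#) → ∑ n f ≈ 0#
  ∑-zero n f f≈0 = trans (∑-cong n f≈0) (∑0 n)
    where
    ∑0 : ∀ n → ∑ n (λ _ → 0#) ≈ 0#
    ∑0 zero    = refl
    ∑0 (suc n) = trans (+-identityʳ _) (∑0 n)

  ∑-+ : ∀ n f g → ∑ n (λ k → f k + g k) ≈ ∑ n f + ∑ n g
  ∑-+ zero    f g = refl
  ∑-+ (suc n) f g = trans (+-congʳ (∑-+ n f g))
    (solve 4 (λ a b x y → (a :+ b) :+ (x :+ y) := (a :+ x) :+ (b :+ y)) refl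
      (∑ n f) (∑ n g) (f (suc n)) (g (suc n)))

  ∑-*ˡ : ∀ n x f → x * ∑ n f ≈ ∑ n (λ k → x * f k)
  ∑-*ˡ zero    x f = refl
  ∑-*ˡ (suc n) x f = trans (distribˡ x (∑ n f) (f (suc n))) (+-congʳ (∑-*ˡ n x f))

  ∑-*ʳ : ∀ n x f → ∑ n f * x ≈ ∑ n (λ k → f k * x)
  ∑-*ʳ zero    x f = refl
  ∑-*ʳ (suc n) x f = trans (distribʳ x (∑ n f) (f (suc n))) (+-congʳ (∑-*ʳ n x f))

  ∑-first : ∀ n f → ∑ (suc n) f ≈ f 0 + ∑ n (λ k → f (suc k))
  ∑-first zero    f = refl
  ∑-first (suc n) f = trans (+-congʳ (∑-first n f)) (+-assoc _ _ _)

  ∑-last : ∀ n f → (∀ k → k < n → f k ≈ 0#) → ∑ n f ≈ f n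
  ∑-last zero    f f≈0 = refl
  ∑-last (suc n) f f≈0 =
    trans (+-congʳ (∑-zero n f (λ k k≤n → f≈0 k (s≤s k≤n)))) (+-identityˡ _)

  ∑-truncate : ∀ i M f → i ≤ M → (∀ k → i < k → k ≤ M → f k ≈ 0#) → ∑ M f ≈ ∑ i f
  ∑-truncate i zero    f z≤n f≈0 = refl
  ∑-truncate i (suc M) f i≤1+M f≈0 with ℕₚ.m≤n⇒m<n∨m≡n i≤1+M
  ... | inj₂ ≡.refl = refl
  ... | inj₁ i<1+M  = begin
    ∑ M f + f (suc M)
      ≈⟨ +-cong (∑-truncate i M f (ℕₚ.≤-pred i<1+M) f≈0′) (f≈0 (suc M) i<1+M ℕₚ.≤-refl) ⟩
    ∑ i f + 0#
      ≈⟨ +-identityʳ _ ⟩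
    ∑ i f ∎
    where
    f≈0′ : ∀ k → i < k → k ≤ M → f k ≈ 0#
    f≈0′ k i<k k≤M = f≈0 k i<k (ℕₚ.m≤n⇒m≤1+n k≤M)

  ∑-reverse : ∀ n f → ∑ n (λ k → f (n ∸ k)) ≈ ∑ n f
  ∑-reverse zero    f = refl
  ∑-reverse (suc n) f = begin
    ∑ n (λ k → f (suc n ∸ k)) + f (n ∸ n)
      ≈⟨ +-cong (∑-cong n (λ k k≤n → reflexive (≡.cong f (ℕₚ.+-∸-assoc 1 k≤n))))
                (reflexive (≡.cong f (ℕₚ.n∸n≡0 n))) ⟩
    ∑ n (λ k → f (suc (n ∸ k))) + f 0 ≈⟨ +-congʳ (∑-reverse n (λ k → f (suc k))) ⟩
    ∑ n (λ k → f (suc k)) + f 0       ≈⟨ +-comm _ _ ⟩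
    f 0 + ∑ n (λ k → f (suc k))       ≈⟨ ∑-first n f ⟨
    ∑ (suc n) f                       ∎

  ∑-swap : ∀ n m (f : ℕ → ℕ → Carrier) →
           ∑ n (λ a → ∑ m (f a)) ≈ ∑ m (λ b → ∑ n (λ a → f a b))
  ∑-swap zero    m f = refl
  ∑-swap (suc n) m f =
    trans (+-congʳ (∑-swap n m f)) (sym (∑-+ m (λ b → ∑ n (λ a → f a b)) (f (suc n))))

module PowerSeries {c ℓ} (R : CommutativeRing c ℓ) where
  open CommutativeRing R
  open FiniteSums R
  open import Relation.Binary.Reasoning.Setoid setoid
  open import Algebra.Solver.Ring.NaturalCoefficients.Default commutativeSemiring
    using (solve; _:+_; _:*_; _:=_)

  Series : Set c
  Series = ℕ → Carrier

  infix  4 _≋_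
  infixl 6 _⊕_
  infixl 7 _⊛_

  _≋_ : Series → Series → Set ℓ
  f ≋ g = ∀ i → f i ≈ g i

  _⊕_ : Series → Series → Series
  (f ⊕ g) i = f i + g i

  ⊖_ : Series → Series
  (⊖ f) i = - f i

  𝟘 : Series
  𝟘 _ = 0#

  X^ : ℕ → Series
  X^ s i = if i ≡ᵇ s then 1# else 0#

  𝟙 : Series
  𝟙 = X^ 0

  _⊛_ : Series → Series → Series
  (f ⊛ g) n = ∑ n (λ k → f k * g (n ∸ k))

  ⊛-cong : ∀ {f f′ g g′} → f ≋ f′ → g ≋ g′ → f ⊛ g ≋ f′ ⊛ g′
  ⊛-cong f≋f′ g≋g′ n = ∑-cong n (λ k _ → *-cong (f≋f′ k) (g≋g′ (n ∸ k)))

  ⊛-suc : ∀ f g n → (f ⊛ g) (suc n) ≈ f 0 * g (suc n) + ((λ k → f (suc k)) ⊛ g) n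
  ⊛-suc f g n = ∑-first n (λ k → f k * g (suc n ∸ k))

  ⊛-distribʳ : ∀ f g h → (f ⊕ g) ⊛ h ≋ f ⊛ h ⊕ g ⊛ h
  ⊛-distribʳ f g h n =
    trans (∑-cong n (λ k _ → distribʳ (h (n ∸ k)) (f k) (g k))) (∑-+ n _ _)

  ⊛-scalarˡ : ∀ x f h n → ((λ k → x * f k) ⊛ h) n ≈ x * (f ⊛ h) n
  ⊛-scalarˡ x f h n =
    trans (∑-cong n (λ k _ → *-assoc x (f k) (h (n ∸ k)))) (sym (∑-*ˡ n x _))

  ⊛-comm : ∀ f g → f ⊛ g ≋ g ⊛ f
  ⊛-comm f g n = begin
    ∑ n (λ k → f k * g (n ∸ k))              ≈⟨ ∑-reverse n (λ k → f k * g (n ∸ k)) ⟨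
    ∑ n (λ k → f (n ∸ k) * g (n ∸ (n ∸ k)))  ≈⟨ ∑-cong n swap-factors ⟩
    ∑ n (λ k → g k * f (n ∸ k))              ∎
    where
    swap-factors : ∀ k → k ≤ n → f (n ∸ k) * g (n ∸ (n ∸ k)) ≈ g k * f (n ∸ k)
    swap-factors k k≤n =
      trans (*-comm _ _) (*-congʳ (reflexive (≡.cong g (ℕₚ.m∸[m∸n]≡n k≤n))))

  ⊛-assoc : ∀ f g h → (f ⊛ g) ⊛ h ≋ f ⊛ (g ⊛ h)
  ⊛-assoc f g h zero    = *-assoc (f 0) (g 0) (h 0)
  ⊛-assoc f g h (suc n) = begin
    ((f ⊛ g) ⊛ h) (suc n)
      ≈⟨ ⊛-suc (f ⊛ g) h n ⟩
    (f 0 * g 0) * h (suc n) + ((λ k → (f ⊛ g) (suc k)) ⊛ h) n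
      ≈⟨ +-congˡ (⊛-cong {g = h} (⊛-suc f g) (λ _ → refl) n) ⟩
    (f 0 * g 0) * h (suc n) + ((f₀g′ ⊕ f′ ⊛ g) ⊛ h) n
      ≈⟨ +-congˡ (⊛-distribʳ f₀g′ (f′ ⊛ g) h n) ⟩
    (f 0 * g 0) * h (suc n) + ((f₀g′ ⊛ h) n + ((f′ ⊛ g) ⊛ h) n)
      ≈⟨ +-congˡ (+-cong (⊛-scalarˡ (f 0) g′ h n) (⊛-assoc f′ g h n)) ⟩
    (f 0 * g 0) * h (suc n) + (f 0 * (g′ ⊛ h) n + (f′ ⊛ (g ⊛ h)) n)
      ≈⟨ solve 5 (λ a b c d e → (a :* b) :* c :+ (a :* d :+ e) := a :* (b :* c :+ d) :+ e) refl
           (f 0) (g 0) (h (suc n)) ((g′ ⊛ h) n) ((f′ ⊛ (g ⊛ h)) n) ⟩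
    f 0 * (g 0 * h (suc n) + (g′ ⊛ h) n) + (f′ ⊛ (g ⊛ h)) n
      ≈⟨ +-congʳ (*-congˡ (⊛-suc g h n)) ⟨
    f 0 * (g ⊛ h) (suc n) + (f′ ⊛ (g ⊛ h)) n
      ≈⟨ ⊛-suc f (g ⊛ h) n ⟨
    (f ⊛ (g ⊛ h)) (suc n) ∎
    where
    f′ g′ f₀g′ : Series
    f′ k = f (suc k)
    g′ k = g (suc k)
    f₀g′ k = f 0 * g (suc k)

  ⊛-identityˡ : ∀ f → 𝟙 ⊛ f ≋ f
  ⊛-identityˡ f zero    = *-identityˡ (f 0)
  ⊛-identityˡ f (suc n) = begin
    (𝟙 ⊛ f) (suc n)
      ≈⟨ ⊛-suc 𝟙 f n ⟩
    1# * f (suc n) + ∑ n (λ k → 0# * f (n ∸ k))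
      ≈⟨ +-cong (*-identityˡ _) (∑-zero n _ (λ k _ → zeroˡ _)) ⟩
    f (suc n) + 0#
      ≈⟨ +-identityʳ _ ⟩
    f (suc n) ∎

  ⊛-identityʳ : ∀ f → f ⊛ 𝟙 ≋ f
  ⊛-identityʳ f n = trans (⊛-comm f 𝟙 n) (⊛-identityˡ f n)

  ⊛-distribˡ : ∀ f g h → f ⊛ (g ⊕ h) ≋ f ⊛ g ⊕ f ⊛ h
  ⊛-distribˡ f g h n = trans (⊛-comm f (g ⊕ h) n)
    (trans (⊛-distribʳ g h f n) (+-cong (⊛-comm g f n) (⊛-comm h f n)))

  seriesRing : CommutativeRing c ℓ
  seriesRing = record
    { Carrier = Series ; _≈_ = _≋_ ; _+_ = _⊕_ ; _*_ = _⊛_ ; -_ = ⊖_ ; 0# = 𝟘 ; 1# = 𝟙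
    ; isCommutativeRing = record
      { isRing = record
        { +-isAbelianGroup = Pointwise.isAbelianGroup +-isAbelianGroup
        ; *-cong = ⊛-cong
        ; *-assoc = ⊛-assoc
        ; *-identity = ⊛-identityˡ , ⊛-identityʳ
        ; distrib = ⊛-distribˡ , (λ h f g → ⊛-distribʳ f g h) }
      ; *-comm = ⊛-comm } }

  module ∑ₛ = FiniteSums seriesRing

  ∑ₛ-coeff : ∀ n (F : ℕ → Series) i → ∑ₛ.∑ n F i ≡ ∑ n (λ a → F a i)
  ∑ₛ-coeff zero    F i = ≡.refl
  ∑ₛ-coeff (suc n) F i = ≡.cong (_+ F (suc n) i) (∑ₛ-coeff n F i)

  C : Carrier → Series
  C x i = if i ≡ᵇ 0 then x else 0#

  C-cong : ∀ {x y} → x ≈ y → C x ≋ C y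
  C-cong x≈y zero    = x≈y
  C-cong x≈y (suc i) = refl

  C-+ : ∀ x y → C (x + y) ≋ C x ⊕ C y
  C-+ x y zero    = refl
  C-+ x y (suc i) = sym (+-identityʳ 0#)

  C-* : ∀ x y → C x ⊛ C y ≋ C (x * y)
  C-* x y zero    = refl
  C-* x y (suc n) = begin
    (C x ⊛ C y) (suc n)                      ≈⟨ ⊛-suc (C x) (C y) n ⟩
    x * 0# + ∑ n (λ k → 0# * C y (n ∸ k))    ≈⟨ +-cong (zeroʳ x) (∑-zero n _ (λ k _ → zeroˡ _)) ⟩
    0# + 0#                                  ≈⟨ +-identityʳ 0# ⟩
    0#                                       ∎

  C-∑ : ∀ n φ → ∑ₛ.∑ n (λ a → C (φ a)) ≋ C (∑ n φ)
  C-∑ zero    φ i = refl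
  C-∑ (suc n) φ i = trans (+-congʳ (C-∑ n φ i)) (sym (C-+ (∑ n φ) (φ (suc n)) i))

  X^-diag : ∀ s → X^ s s ≈ 1#
  X^-diag s with s ≡ᵇ s | ℕₚ.≡⇒≡ᵇ s s ≡.refl
  ... | true  | _  = refl
  ... | false | ()

  X^-off : ∀ {s k} → k ≢ s → X^ s k ≈ 0#
  X^-off {s} {k} k≢s with k ≡ᵇ s | ℕₚ.≡ᵇ⇒≡ k s
  ... | false | _   = refl
  ... | true  | k≡s = ⊥-elim (k≢s (k≡s _))

  X^-shift-below : ∀ s g n → n < s → (X^ s ⊛ g) n ≈ 0#
  X^-shift-below s g n n<s = ∑-zero n _ (λ k k≤n →
    trans (*-congʳ (X^-off (λ k≡s → ℕₚ.<-irrefl k≡s (ℕₚ.≤-<-trans k≤n n<s)))) (zeroˡ _))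

  X^-shift : ∀ s g n → s ≤ n → (X^ s ⊛ g) n ≈ g (n ∸ s)
  X^-shift s g n s≤n = begin
    ∑ n term  ≈⟨ ∑-truncate s n term s≤n (λ k s<k _ → off k (λ k≡s → ℕₚ.<-irrefl (≡.sym k≡s) s<k)) ⟩
    ∑ s term  ≈⟨ ∑-last s term (λ k k<s → off k (ℕₚ.<⇒≢ k<s)) ⟩
    term s    ≈⟨ trans (*-congʳ (X^-diag s)) (*-identityˡ _) ⟩
    g (n ∸ s) ∎
    where
    term : ℕ → Carrier
    term k = X^ s k * g (n ∸ k)
    off : ∀ k → k ≢ s → term k ≈ 0#
    off k k≢s = trans (*-congʳ (X^-off k≢s)) (zeroˡ _)

-- ℚ[[q]] is P₁ (also used as ℚ[[z]]), and ℚ[[q,z]] is P₂ = ℚ[[z]][[q]]: the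
-- coefficient of qⁱ of  F : PS2  is the series  j ↦ F i j  in ℚ[[z]].
module ∑ℚ = FiniteSums ℚₚ.+-*-commutativeRing
module P₁ = PowerSeries ℚₚ.+-*-commutativeRing
module P₂ = PowerSeries P₁.seriesRing
module R₁ = CommutativeRing P₁.seriesRing
module R₂ = CommutativeRing P₂.seriesRing

-- Definitionally,  +ₚ, +₂, neg₂
-- are the ring sums and negation, oneₚ = 𝟙, qPow n = Xⁿ, and  embed f  is the
-- series whose coefficient of qⁱ is the constant series  f i  in ℚ[[z]].
∑-sumTo : ∀ n f → ∑ℚ.∑ n f ≡ sumTo n f
∑-sumTo zero    f = ≡.refl
∑-sumTo (suc n) f = ≡.cong (_ℚ+ f (suc n)) (∑-sumTo n f)

sumTo-cong : ∀ n f g → (∀ k → k ≤ n → f k ≡ g k) → sumTo n f ≡ sumTo n g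
sumTo-cong n f g f≡g = ≡.trans (≡.sym (∑-sumTo n f)) (≡.trans (∑ℚ.∑-cong n f≡g) (∑-sumTo n g))

sumTo-truncate : ∀ i M f → i ≤ M → (∀ k → i < k → f k ≡ 0ℚ) → sumTo M f ≡ sumTo i f
sumTo-truncate i M f i≤M f≡0 = begin
  sumTo M f   ≡⟨ ∑-sumTo M f ⟨
  ∑ℚ.∑ M f    ≡⟨ ∑ℚ.∑-truncate i M f i≤M (λ k i<k _ → f≡0 k i<k) ⟩
  ∑ℚ.∑ i f    ≡⟨ ∑-sumTo i f ⟩
  sumTo i f   ∎
  where open ≡.≡-Reasoning

∑₂-coeff : ∀ n (F : ℕ → PS2) i j → P₂.∑ₛ.∑ n F i j ≡ sumTo n (λ a → F a i j)
∑₂-coeff n F i j = begin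
  P₂.∑ₛ.∑ n F i j             ≡⟨ ≡.cong (λ f → f j) (P₂.∑ₛ-coeff n F i) ⟩
  P₁.∑ₛ.∑ n (λ a → F a i) j   ≡⟨ P₁.∑ₛ-coeff n (λ a → F a i) j ⟩
  ∑ℚ.∑ n (λ a → F a i j)      ≡⟨ ∑-sumTo n _ ⟩
  sumTo n (λ a → F a i j)     ∎
  where open ≡.≡-Reasoning

*ₚ-⊛ : ∀ f g → f *ₚ g P₁.≋ f P₁.⊛ g
*ₚ-⊛ f g n = ≡.sym (∑-sumTo n _)

*₂-⊛ : ∀ F G → F *₂ G P₂.≋ F P₂.⊛ G
*₂-⊛ F G i j = ≡.sym (begin
  P₁.∑ₛ.∑ i (λ a → F a P₁.⊛ G (i ∸ a)) j
    ≡⟨ P₁.∑ₛ-coeff i _ j ⟩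
  ∑ℚ.∑ i (λ a → (F a P₁.⊛ G (i ∸ a)) j)
    ≡⟨ ∑ℚ.∑-cong i (λ a _ → ∑-sumTo j _) ⟩
  ∑ℚ.∑ i (λ a → sumTo j (λ b → F a b ℚ* G (i ∸ a) (j ∸ b)))
    ≡⟨ ∑-sumTo i _ ⟩
  (F *₂ G) i j ∎)
  where open ≡.≡-Reasoning

*₂-≋ : ∀ {F F′ G G′} → F P₂.≋ F′ → G P₂.≋ G′ → ∀ i j → (F *₂ G) i j ≡ (F′ P₂.⊛ G′) i j
*₂-≋ {F} {F′} {G} {G′} F≋F′ G≋G′ i j =
  ≡.trans (*₂-⊛ F G i j) (P₂.⊛-cong {F} {F′} {G} {G′} F≋F′ G≋G′ i j)

module _ where
  open P₂ using (_≋_; _⊕_; _⊛_; ⊖_; 𝟘; 𝟙)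

  embed-cong : ∀ {f g} → f P₁.≋ g → embed f ≋ embed g
  embed-cong f≋g i = P₁.C-cong (f≋g i)

  embed-+ : ∀ f g → embed (f P₁.⊕ g) ≋ embed f ⊕ embed g
  embed-+ f g i = P₁.C-+ (f i) (g i)

  embed-⊖ : ∀ f → embed (P₁.⊖ f) ≋ ⊖ embed f
  embed-⊖ f i zero    = ≡.refl
  embed-⊖ f i (suc j) = ≡.refl

  embed-* : ∀ f g → embed f ⊛ embed g ≋ embed (f P₁.⊛ g)
  embed-* f g i = R₁.trans (P₁.∑ₛ.∑-cong i (λ a _ → P₁.C-* (f a) (g (i ∸ a))))
                           (P₁.C-∑ i (λ a → f a ℚ* g (i ∸ a)))

  embed-𝟘 : embed P₁.𝟘 ≋ 𝟘
  embed-𝟘 i zero    = ≡.refl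
  embed-𝟘 i (suc j) = ≡.refl

  embed-𝟙 : embed P₁.𝟙 ≋ 𝟙
  embed-𝟙 zero    j       = ≡.refl
  embed-𝟙 (suc i) zero    = ≡.refl
  embed-𝟙 (suc i) (suc j) = ≡.refl

  embed-∑ : ∀ n φ → P₂.∑ₛ.∑ n (λ a → embed (φ a)) ≋ embed (P₁.∑ₛ.∑ n φ)
  embed-∑ zero    φ = R₂.refl
  embed-∑ (suc n) φ =
    R₂.trans (R₂.+-congʳ (embed-∑ n φ)) (R₂.sym (embed-+ (P₁.∑ₛ.∑ n φ) (φ (suc n))))

  embed-𝟘-⊛ : ∀ {f} X → f ≡ P₁.𝟘 → embed f ⊛ X ≋ 𝟘
  embed-𝟘-⊛ X ≡.refl = R₂.trans (R₂.*-congʳ {X} embed-𝟘) (R₂.zeroˡ X)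

-- The q-analogue 1/[k+1] = (1-q)/(1-q^{k+1}):  geomInv k = Σ_t q^{(k+1)t}  inverts
-- 1 - q^{k+1}, because its coefficients are periodic with period k+1.
module _ where
  open P₁ using (_≋_; _⊕_; _⊛_; ⊖_; 𝟙; X^)

  geomInv-low : ∀ k n → n < suc k → geomInv k n ≡ 𝟙 n
  geomInv-low k n n<1+k = ≡.cong (λ r → if r ≡ᵇ 0 then 1ℚ else 0ℚ) (m<n⇒m%n≡m n<1+k)

  geomInv-periodic : ∀ k n → suc k ≤ n → geomInv k n ≡ geomInv k (n ∸ suc k)
  geomInv-periodic k n 1+k≤n =
    ≡.cong (λ r → if r ≡ᵇ 0 then 1ℚ else 0ℚ) (≡.sym (m≤n⇒[n∸m]%m≡n%m 1+k≤n))

  geomInv-inverse : ∀ k → (𝟙 ⊕ ⊖ X^ (suc k)) ⊛ geomInv k ≋ 𝟙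
  geomInv-inverse k n = begin
    ((𝟙 ⊕ ⊖ X^ s) ⊛ g) n
      ≡⟨ P₁.⊛-distribʳ 𝟙 (⊖ X^ s) g n ⟩
    (𝟙 ⊛ g) n ℚ+ ((⊖ X^ s) ⊛ g) n
      ≡⟨ ≡.cong₂ _ℚ+_ (P₁.⊛-identityˡ g n) (≡.sym (-‿distribˡ-* (X^ s) g n)) ⟩
    g n ℚ+ ℚ- (X^ s ⊛ g) n
      ≡⟨ coefficient n ⟩
    𝟙 n ∎
    where
    open ≡.≡-Reasoning
    open import Algebra.Properties.Ring R₁.ring using (-‿distribˡ-*)
    s = suc k
    g = geomInv k
    coefficient : ∀ n → g n ℚ+ ℚ- (X^ s ⊛ g) n ≡ 𝟙 n
    coefficient n with n <? s
    ... | yes n<s = begin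
      g n ℚ+ ℚ- (X^ s ⊛ g) n ≡⟨ ≡.cong (λ x → g n ℚ+ ℚ- x) (P₁.X^-shift-below s g n n<s) ⟩
      g n ℚ+ 0ℚ              ≡⟨ ℚₚ.+-identityʳ (g n) ⟩
      g n                    ≡⟨ geomInv-low k n n<s ⟩
      𝟙 n                    ∎
    ... | no n≮s = begin
      g n ℚ+ ℚ- (X^ s ⊛ g) n
        ≡⟨ ≡.cong₂ (λ x y → x ℚ+ ℚ- y) (geomInv-periodic k n s≤n) (P₁.X^-shift s g n s≤n) ⟩
      g (n ∸ s) ℚ+ ℚ- g (n ∸ s)
        ≡⟨ ℚₚ.+-inverseʳ (g (n ∸ s)) ⟩
      0ℚ
        ≡⟨ positive n s≤n ⟩
      𝟙 n ∎
      where
      s≤n = ℕₚ.≮⇒≥ n≮s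
      positive : ∀ n → s ≤ n → 0ℚ ≡ 𝟙 n
      positive (suc n) _ = ≡.refl

  oneMinusQ-≋ : oneMinusQ ≋ 𝟙 ⊕ ⊖ X^ 1
  oneMinusQ-≋ zero          = ≡.refl
  oneMinusQ-≋ (suc zero)    = ≡.refl
  oneMinusQ-≋ (suc (suc i)) = ≡.refl

  invQint-0 : invQint 0 ≋ 𝟙
  invQint-0 n = begin
    (oneMinusQ *ₚ geomInv 0) n     ≡⟨ *ₚ-⊛ oneMinusQ (geomInv 0) n ⟩
    (oneMinusQ ⊛ geomInv 0) n      ≡⟨ P₁.⊛-cong {g = geomInv 0} oneMinusQ-≋ (λ _ → ≡.refl) n ⟩
    ((𝟙 ⊕ ⊖ X^ 1) ⊛ geomInv 0) n   ≡⟨ geomInv-inverse 0 n ⟩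
    𝟙 n                            ∎
    where open ≡.≡-Reasoning

-- The list  dec m b  enumerates
-- the m-subsets of {1,…,b} (as decreasing lists), so  elemSym m b = e_m(1/[1],…,1/[b])
-- and  a_{z₁^{m+1}}(k) = e_m(1/[1],…,1/[k]) / [k+1].
module _ where
  open P₁ using (_≋_; _⊕_; _⊛_; 𝟘; 𝟙)

  subsetProduct : List ℕ → PS
  subsetProduct t = prodListₚ (map invBracket t)

  elemSym : ℕ → ℕ → PS
  elemSym m b = sumListₚ (map subsetProduct (dec m b))

  -- an (m+1)-subset of {1,…,k+1} avoids k+1, or is k+1 on top of an m-subset of {1,…,k}
  dec-suc : ∀ m k → dec (suc m) (suc k) ≡ dec (suc m) k ++ map (suc k ∷_) (dec m k)
  dec-suc m k = begin
    concatMap top (upTo (suc k))      ≡⟨ ≡.cong (concatMap top) (Listₚ.upTo-∷ʳ k) ⟨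
    concatMap top (upTo k ++ [ k ])   ≡⟨ Listₚ.concatMap-++ top (upTo k) [ k ] ⟩
    dec (suc m) k ++ (top k ++ [])    ≡⟨ ≡.cong (dec (suc m) k ++_) (Listₚ.++-identityʳ (top k)) ⟩
    dec (suc m) k ++ top k            ∎
    where
    open ≡.≡-Reasoning
    top : ℕ → List (List ℕ)
    top s = map (suc s ∷_) (dec m s)

  dec-empty : ∀ m b → b < m → dec m b ≡ []
  dec-empty (suc m) zero    _         = ≡.refl
  dec-empty (suc m) (suc b) (s≤s b<m) = ≡.trans (dec-suc m b)
    (≡.cong₂ _++_ (dec-empty (suc m) b (ℕₚ.m<n⇒m<1+n b<m))
                  (≡.cong (map (suc b ∷_)) (dec-empty m b b<m)))

  sumList-++ : ∀ xs ys → sumListₚ (xs ++ ys) ≋ sumListₚ xs ⊕ sumListₚ ys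
  sumList-++ []       ys i = ≡.sym (ℚₚ.+-identityˡ _)
  sumList-++ (x ∷ xs) ys i =
    ≡.trans (≡.cong (x i ℚ+_) (sumList-++ xs ys i)) (≡.sym (ℚₚ.+-assoc (x i) _ _))

  sumList-top : ∀ k L → sumListₚ (map subsetProduct (map (suc k ∷_) L))
                        ≋ invQint k ⊛ sumListₚ (map subsetProduct L)
  sumList-top k []      = R₁.sym (R₁.zeroʳ (invQint k))
  sumList-top k (t ∷ L) =
    R₁.trans (R₁.+-cong (*ₚ-⊛ (invQint k) (subsetProduct t)) (sumList-top k L))
             (R₁.sym (R₁.distribˡ (invQint k) (subsetProduct t) (sumListₚ (map subsetProduct L))))

  aZ-elemSym : ∀ m k → aZ (suc m) k ≋ invQint k ⊛ elemSym m k
  aZ-elemSym m k = sumList-top k (dec m k)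

  aZ-vanish : ∀ m k → k < m → aZ (suc m) k ≡ 𝟘
  aZ-vanish m k k<m =
    ≡.cong (λ L → sumListₚ (map subsetProduct (map (suc k ∷_) L))) (dec-empty m k k<m)

  elemSym-vanish : ∀ m b → b < m → elemSym m b ≡ 𝟘
  elemSym-vanish m b b<m = ≡.cong (λ L → sumListₚ (map subsetProduct L)) (dec-empty m b b<m)

  elemSym-0 : ∀ b → elemSym 0 b ≋ 𝟙
  elemSym-0 b i = ℚₚ.+-identityʳ _

  elemSym-suc : ∀ m k → elemSym (suc m) (suc k) ≋ elemSym (suc m) k ⊕ invQint k ⊛ elemSym m k
  elemSym-suc m k = begin
    sumListₚ (map subsetProduct (dec (suc m) (suc k)))
      ≡⟨ ≡.cong (λ L → sumListₚ (map subsetProduct L)) (dec-suc m k) ⟩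
    sumListₚ (map subsetProduct (dec (suc m) k ++ map (suc k ∷_) (dec m k)))
      ≡⟨ ≡.cong sumListₚ (Listₚ.map-++ subsetProduct (dec (suc m) k) _) ⟩
    sumListₚ (map subsetProduct (dec (suc m) k) ++ map subsetProduct (map (suc k ∷_) (dec m k)))
      ≈⟨ sumList-++ (map subsetProduct (dec (suc m) k)) _ ⟩
    elemSym (suc m) k ⊕ sumListₚ (map subsetProduct (map (suc k ∷_) (dec m k)))
      ≈⟨ R₁.+-congˡ {elemSym (suc m) k} (sumList-top k (dec m k)) ⟩
    elemSym (suc m) k ⊕ invQint k ⊛ elemSym m k ∎
    where open import Relation.Binary.Reasoning.Setoid R₁.setoid

open P₂ using (_≋_; _⊕_; _⊛_; ⊖_; 𝟘; 𝟙)

module _ where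
  open import Relation.Binary.Reasoning.Setoid R₂.setoid
  open import Algebra.Solver.Ring.NaturalCoefficients.Default R₂.commutativeSemiring
    using (solve; _:+_; _:*_; _:=_)

  W : PS2
  W = (zVar ⊕ ⊖ 𝟙) ⊛ embed (geomInv 0)

  ρ : ℕ → PS2
  ρ k = (zVar ⊕ ⊖ embed (P₁.X^ k)) ⊛ embed (geomInv k)

  Bᵣ : ℕ → PS2
  Bᵣ zero    = 𝟙
  Bᵣ (suc n) = Bᵣ n ⊛ ρ n

  W^ : ℕ → PS2
  W^ zero    = 𝟙
  W^ (suc m) = W^ m ⊛ W

  one₂-𝟙 : one₂ ≋ 𝟙
  one₂-𝟙 zero    j = ≡.refl
  one₂-𝟙 (suc i) j = ≡.refl

  w-W : w ≋ W
  w-W = R₂.trans (*₂-⊛ (zVar +₂ neg₂ one₂) (embed (geomInv 0)))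
    (P₂.⊛-cong {g = embed (geomInv 0)} (R₂.+-congˡ {zVar} (R₂.-‿cong {one₂} {𝟙} one₂-𝟙)) R₂.refl)

  B-Bᵣ : ∀ n → B n ≋ Bᵣ n
  B-Bᵣ zero    = one₂-𝟙
  B-Bᵣ (suc n) = R₂.trans (*₂-⊛ (B n) (factor *₂ embed (geomInv n)))
                          (P₂.⊛-cong (B-Bᵣ n) (*₂-⊛ factor (embed (geomInv n))))
    where
    factor : PS2
    factor = zVar +₂ neg₂ (embed (qPow n))

  pow-W^ : ∀ m → pow₂ w m ≋ W^ m
  pow-W^ zero    = one₂-𝟙
  pow-W^ (suc m) = R₂.trans (*₂-⊛ (pow₂ w m) w) (P₂.⊛-cong (pow-W^ m) w-W)

  ι : ℕ → PS2
  ι k = embed (invQint k)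

  ι-factor : ∀ k → ι k ≋ embed oneMinusQ ⊛ embed (geomInv k)
  ι-factor k = R₂.trans (embed-cong (*ₚ-⊛ oneMinusQ (geomInv k)))
                        (R₂.sym (embed-* oneMinusQ (geomInv k)))

  ι-0 : ι 0 ≋ 𝟙
  ι-0 = R₂.trans (embed-cong invQint-0) embed-𝟙

  one-minus-qPow-inverse : ∀ k → (𝟙 ⊕ ⊖ embed (P₁.X^ (suc k))) ⊛ embed (geomInv k) ≋ 𝟙
  one-minus-qPow-inverse k = begin
    (𝟙 ⊕ ⊖ embed q^) ⊛ embed (geomInv k)
      ≈⟨ R₂.*-congʳ {embed (geomInv k)} (R₂.+-cong (R₂.sym embed-𝟙) (R₂.sym (embed-⊖ q^))) ⟩
    (embed P₁.𝟙 ⊕ embed (P₁.⊖ q^)) ⊛ embed (geomInv k)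
      ≈⟨ R₂.*-congʳ {embed (geomInv k)} (R₂.sym (embed-+ P₁.𝟙 (P₁.⊖ q^))) ⟩
    embed (P₁.𝟙 P₁.⊕ P₁.⊖ q^) ⊛ embed (geomInv k)
      ≈⟨ embed-* _ (geomInv k) ⟩
    embed ((P₁.𝟙 P₁.⊕ P₁.⊖ q^) P₁.⊛ geomInv k)
      ≈⟨ R₂.trans (embed-cong (geomInv-inverse k)) embed-𝟙 ⟩
    𝟙 ∎
    where
    q^ : PS
    q^ = P₁.X^ (suc k)

  split-at-1 : ∀ Q → zVar ⊕ ⊖ Q ≋ (zVar ⊕ ⊖ 𝟙) ⊕ (𝟙 ⊕ ⊖ Q)
  split-at-1 Q = R₂.sym (begin
    (zVar ⊕ ⊖ 𝟙) ⊕ (𝟙 ⊕ ⊖ Q) ≈⟨ R₂.+-assoc zVar (⊖ 𝟙) (𝟙 ⊕ ⊖ Q) ⟩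
    zVar ⊕ (⊖ 𝟙 ⊕ (𝟙 ⊕ ⊖ Q)) ≈⟨ R₂.+-congˡ {zVar} (R₂.sym (R₂.+-assoc (⊖ 𝟙) 𝟙 (⊖ Q))) ⟩
    zVar ⊕ ((⊖ 𝟙 ⊕ 𝟙) ⊕ ⊖ Q) ≈⟨ R₂.+-congˡ {zVar} (R₂.+-congʳ (R₂.-‿inverseˡ 𝟙)) ⟩
    zVar ⊕ (𝟘 ⊕ ⊖ Q)         ≈⟨ R₂.+-congˡ {zVar} (R₂.+-identityˡ (⊖ Q)) ⟩
    zVar ⊕ ⊖ Q               ∎)

  ρ-0 : ρ 0 ≋ W
  ρ-0 = P₂.⊛-cong {g = embed (geomInv 0)}
    (R₂.+-congˡ {zVar} (R₂.-‿cong {embed P₁.𝟙} {𝟙} embed-𝟙)) R₂.refl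

  ρ-step : ∀ k → ι k ⊛ ρ (suc k) ≋ ι (suc k) ⊛ (𝟙 ⊕ ι k ⊛ W)
  ρ-step k = begin
    ι k ⊛ ρ (suc k)
      ≈⟨ R₂.*-cong (ι-factor k) (R₂.*-congʳ {d} (split-at-1 (embed (P₁.X^ (suc k))))) ⟩
    (a ⊛ b) ⊛ ((X ⊕ Y) ⊛ d)
      ≈⟨ solve 5 (λ a b X Y d → (a :* b) :* ((X :+ Y) :* d)
                             := (a :* b :* X :* d) :+ (a :* d) :* (Y :* b)) R₂.refl a b X Y d ⟩
    (a ⊛ b ⊛ X ⊛ d) ⊕ (a ⊛ d) ⊛ (Y ⊛ b)
      ≈⟨ R₂.+-cong (R₂.sym (R₂.trans (R₂.*-congˡ {abXd} a-g) (R₂.*-identityʳ abXd)))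
                   (R₂.*-congˡ {a ⊛ d} (one-minus-qPow-inverse k)) ⟩
    (a ⊛ b ⊛ X ⊛ d) ⊛ (a ⊛ g) ⊕ (a ⊛ d) ⊛ 𝟙
      ≈⟨ solve 6 (λ a b X d g o → (a :* b :* X :* d) :* (a :* g) :+ (a :* d) :* o
                                := (a :* d) :* (o :+ (a :* b) :* (X :* g))) R₂.refl a b X d g 𝟙 ⟩
    (a ⊛ d) ⊛ (𝟙 ⊕ (a ⊛ b) ⊛ (X ⊛ g))
      ≈⟨ R₂.*-cong (ι-factor (suc k)) (R₂.+-congˡ {𝟙} (R₂.*-congʳ {W} (ι-factor k))) ⟨
    ι (suc k) ⊛ (𝟙 ⊕ ι k ⊛ W) ∎
    where
    a b d g X Y abXd : PS2
    a = embed oneMinusQ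
    b = embed (geomInv k)
    d = embed (geomInv (suc k))
    g = embed (geomInv 0)
    X = zVar ⊕ ⊖ 𝟙
    Y = 𝟙 ⊕ ⊖ embed (P₁.X^ (suc k))
    abXd = a ⊛ b ⊛ X ⊛ d
    a-g : a ⊛ g ≋ 𝟙
    a-g = R₂.trans (R₂.sym (ι-factor 0)) ι-0

  -- Generating function of the elementary symmetric functions of 1/[1],…,1/[k]:
  --   E k = Σ_{m≤k} e_m(1/[1],…,1/[k]) Wᵐ = ∏_{t=1}^{k} (1 + W/[t]).
  E : ℕ → PS2
  E k = P₂.∑ₛ.∑ k (λ m → embed (elemSym m k) ⊛ W^ m)

  E-0 : E 0 ≋ 𝟙
  E-0 = R₂.trans (R₂.*-identityʳ (embed (elemSym 0 0)))
                 (R₂.trans (embed-cong (elemSym-0 0)) embed-𝟙)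

  E-suc : ∀ k → E (suc k) ≋ E k ⊛ (𝟙 ⊕ ι k ⊛ W)
  E-suc k = begin
    E (suc k)
      ≈⟨ ∑-first k (λ m → embed (elemSym m (suc k)) ⊛ W^ m) ⟩
    A 0 ⊕ ∑ k (λ m → embed (elemSym (suc m) (suc k)) ⊛ W^ (suc m))
      ≈⟨ R₂.+-congˡ {A 0} (R₂.trans (∑-cong k (λ m _ → term-split m)) (∑-+ k (λ m → A (suc m)) T)) ⟩
    A 0 ⊕ (∑ k (λ m → A (suc m)) ⊕ ∑ k T)
      ≈⟨ R₂.+-assoc (A 0) _ _ ⟨
    (A 0 ⊕ ∑ k (λ m → A (suc m))) ⊕ ∑ k T
      ≈⟨ R₂.+-congʳ lower-part ⟩
    E k ⊕ ∑ k T
      ≈⟨ R₂.+-cong (R₂.*-identityʳ (E k)) upper-part ⟨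
    E k ⊛ 𝟙 ⊕ E k ⊛ (ι k ⊛ W)
      ≈⟨ R₂.distribˡ (E k) 𝟙 (ι k ⊛ W) ⟨
    E k ⊛ (𝟙 ⊕ ι k ⊛ W) ∎
    where
    open P₂.∑ₛ
    A T : ℕ → PS2
    A m = embed (elemSym m k) ⊛ W^ m
    T m = embed (invQint k P₁.⊛ elemSym m k) ⊛ W^ (suc m)
    term-split : ∀ m → embed (elemSym (suc m) (suc k)) ⊛ W^ (suc m) ≋ A (suc m) ⊕ T m
    term-split m = R₂.trans
      (R₂.*-congʳ {W^ (suc m)}
         (R₂.trans (embed-cong (elemSym-suc m k)) (embed-+ (elemSym (suc m) k) _)))
      (R₂.distribʳ (W^ (suc m)) (embed (elemSym (suc m) k)) _)
    -- e_{k+1}(1/[1],…,1/[k]) = 0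
    lower-part : A 0 ⊕ ∑ k (λ m → A (suc m)) ≋ E k
    lower-part = R₂.trans (R₂.sym (∑-first k A)) (∑-truncate k (suc k) A (ℕₚ.n≤1+n k) top-vanishes)
      where
      top-vanishes : ∀ m → k < m → m ≤ suc k → A m ≋ 𝟘
      top-vanishes m k<m _ = embed-𝟘-⊛ (W^ m) (elemSym-vanish m k k<m)
    T-factor : ∀ m → A m ⊛ (ι k ⊛ W) ≋ T m
    T-factor m = R₂.trans
      (solve 4 (λ x p i w → (x :* p) :* (i :* w) := (i :* x) :* (p :* w)) R₂.refl
         (embed (elemSym m k)) (W^ m) (ι k) W)
      (R₂.*-congʳ {W^ (suc m)} (embed-* (invQint k) (elemSym m k)))
    upper-part : E k ⊛ (ι k ⊛ W) ≋ ∑ k T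
    upper-part = R₂.trans (∑-*ʳ k (ι k ⊛ W) A) (∑-cong k (λ m _ → T-factor m))

  B-factor : ∀ k → Bᵣ (suc k) ≋ (ι k ⊛ W) ⊛ E k
  B-factor zero = begin
    𝟙 ⊛ ρ 0          ≈⟨ R₂.trans (R₂.*-identityˡ (ρ 0)) ρ-0 ⟩
    W                ≈⟨ R₂.trans (R₂.*-cong ι₀W E-0) (R₂.*-identityʳ W) ⟨
    (ι 0 ⊛ W) ⊛ E 0  ∎
    where
    ι₀W : ι 0 ⊛ W ≋ W
    ι₀W = R₂.trans (R₂.*-congʳ {W} ι-0) (R₂.*-identityˡ W)
  B-factor (suc k) = begin
    Bᵣ (suc k) ⊛ ρ (suc k)
      ≈⟨ R₂.*-congʳ {ρ (suc k)} (B-factor k) ⟩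
    ((ι k ⊛ W) ⊛ E k) ⊛ ρ (suc k)
      ≈⟨ solve 4 (λ i w e r → ((i :* w) :* e) :* r := (w :* e) :* (i :* r)) R₂.refl
           (ι k) W (E k) (ρ (suc k)) ⟩
    (W ⊛ E k) ⊛ (ι k ⊛ ρ (suc k))
      ≈⟨ R₂.*-congˡ {W ⊛ E k} (ρ-step k) ⟩
    (W ⊛ E k) ⊛ (ι (suc k) ⊛ F)
      ≈⟨ solve 4 (λ w e j f → (w :* e) :* (j :* f) := (j :* w) :* (e :* f)) R₂.refl
           W (E k) (ι (suc k)) F ⟩
    (ι (suc k) ⊛ W) ⊛ (E k ⊛ F)
      ≈⟨ R₂.*-congˡ {ι (suc k) ⊛ W} (E-suc k) ⟨
    (ι (suc k) ⊛ W) ⊛ E (suc k) ∎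
    where
    F : PS2
    F = 𝟙 ⊕ ι k ⊛ W

  B-expansion : ∀ k M → k ≤ M → Bᵣ (suc k) ≋ P₂.∑ₛ.∑ M (λ m → embed (aZ (suc m) k) ⊛ W^ (suc m))
  B-expansion k M k≤M = begin
    Bᵣ (suc k)                                           ≈⟨ B-factor k ⟩
    (ι k ⊛ W) ⊛ E k                                      ≈⟨ ∑-*ˡ k (ι k ⊛ W) _ ⟩
    ∑ k (λ m → (ι k ⊛ W) ⊛ (embed (elemSym m k) ⊛ W^ m)) ≈⟨ ∑-cong k (λ m _ → term m) ⟩
    ∑ k G                                                ≈⟨ ∑-truncate k M G k≤M G-vanishes ⟨
    ∑ M G                                                ∎
    where
    open P₂.∑ₛ
    G : ℕ → PS2
    G m = embed (aZ (suc m) k) ⊛ W^ (suc m)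
    term : ∀ m → (ι k ⊛ W) ⊛ (embed (elemSym m k) ⊛ W^ m) ≋ G m
    term m = R₂.trans
      (solve 4 (λ i w x p → (i :* w) :* (x :* p) := (i :* x) :* (p :* w)) R₂.refl
         (ι k) W (embed (elemSym m k)) (W^ m))
      (R₂.*-congʳ {W^ (suc m)}
         (R₂.trans (embed-* (invQint k) (elemSym m k)) (embed-cong (R₁.sym (aZ-elemSym m k)))))
    G-vanishes : ∀ m → k < m → m ≤ M → G m ≋ 𝟘
    G-vanishes m k<m _ = embed-𝟘-⊛ (W^ (suc m)) (aZ-vanish m k k<m)

partialInner : (ℕ → PS) → ℕ → ℕ → PS
partialInner c M m = P₁.∑ₛ.∑ M (λ n → c (suc n) P₁.⊛ aZ (suc m) n)

truncated-identity : ∀ (c : ℕ → PS) M →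
  P₂.∑ₛ.∑ (suc M) (λ n → embed (c n) ⊛ Bᵣ n)
    ≋ embed (c 0) ⊕ P₂.∑ₛ.∑ M (λ m → embed (partialInner c M m) ⊛ W^ (suc m))
truncated-identity c M = begin
  ∑ (suc M) (λ n → embed (c n) ⊛ Bᵣ n)
    ≈⟨ ∑-first M (λ n → embed (c n) ⊛ Bᵣ n) ⟩
  embed (c 0) ⊛ 𝟙 ⊕ ∑ M (λ n → embed (c (suc n)) ⊛ Bᵣ (suc n))
    ≈⟨ R₂.+-cong (R₂.*-identityʳ (embed (c 0))) (∑-cong M expand) ⟩
  c₀ ⊕ ∑ M (λ n → embed (c (suc n)) ⊛ ∑ M (G n))
    ≈⟨ R₂.+-congˡ {c₀} (∑-cong M (λ n _ → ∑-*ˡ M (embed (c (suc n))) (G n))) ⟩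
  c₀ ⊕ ∑ M (λ n → ∑ M (λ m → embed (c (suc n)) ⊛ G n m))
    ≈⟨ R₂.+-congˡ {c₀} (∑-cong M (λ n _ → ∑-cong M (λ m _ → merge n m))) ⟩
  c₀ ⊕ ∑ M (λ n → ∑ M (H n))
    ≈⟨ R₂.+-congˡ {c₀} (∑-swap M M H) ⟩
  c₀ ⊕ ∑ M (λ m → ∑ M (λ n → H n m))
    ≈⟨ R₂.+-congˡ {c₀} (∑-cong M (λ m _ → collect m)) ⟩
  c₀ ⊕ ∑ M (λ m → embed (partialInner c M m) ⊛ W^ (suc m)) ∎
  where
  open P₂.∑ₛ
  open import Relation.Binary.Reasoning.Setoid R₂.setoid
  c₀ : PS2
  c₀ = embed (c 0)
  G H : ℕ → ℕ → PS2
  G n m = embed (aZ (suc m) n) ⊛ W^ (suc m)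
  H n m = embed (c (suc n) P₁.⊛ aZ (suc m) n) ⊛ W^ (suc m)
  expand : ∀ n → n ≤ M → embed (c (suc n)) ⊛ Bᵣ (suc n) ≋ embed (c (suc n)) ⊛ ∑ M (G n)
  expand n n≤M = R₂.*-congˡ {embed (c (suc n))} (B-expansion n M n≤M)
  merge : ∀ n m → embed (c (suc n)) ⊛ G n m ≋ H n m
  merge n m = R₂.trans (R₂.sym (R₂.*-assoc (embed (c (suc n))) (embed (aZ (suc m) n)) (W^ (suc m))))
                       (R₂.*-congʳ {W^ (suc m)} (embed-* (c (suc n)) (aZ (suc m) n)))
  collect : ∀ m → ∑ M (λ n → H n m) ≋ embed (partialInner c M m) ⊛ W^ (suc m)
  collect m = R₂.trans (R₂.sym (∑-*ʳ M (W^ (suc m)) (λ n → embed (c (suc n) P₁.⊛ aZ (suc m) n))))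
                       (R₂.*-congʳ {W^ (suc m)} (embed-∑ M (λ n → c (suc n) P₁.⊛ aZ (suc m) n)))

ValAtLeast : ℕ → PS → Set
ValAtLeast n f = ∀ i → i < n → f i ≡ 0ℚ

*ₚ-val : ∀ n f g → ValAtLeast n f → ValAtLeast n (f *ₚ g)
*ₚ-val n f g v-f i i<n = ≡.trans (*ₚ-⊛ f g i) (∑ℚ.∑-zero i _ (λ a a≤i →
  ≡.trans (≡.cong (_ℚ* g (i ∸ a)) (v-f a (ℕₚ.≤-<-trans a≤i i<n))) (ℚₚ.*-zeroˡ (g (i ∸ a)))))

embed-*₂-local : ∀ f g G i j → (∀ a → a ≤ i → f a ≡ g a) → (embed f *₂ G) i j ≡ (embed g *₂ G) i j
embed-*₂-local f g G i j f≡g = sumTo-cong i _ _ (λ a a≤i → sumTo-cong j _ _ (λ b _ →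
  ≡.cong (_ℚ* G (i ∸ a) (j ∸ b)) (embed-coeff a b a≤i)))
  where
  embed-coeff : ∀ a b → a ≤ i → embed f a b ≡ embed g a b
  embed-coeff a zero    a≤i = f≡g a a≤i
  embed-coeff a (suc b) a≤i = ≡.refl

embed-*₂-val : ∀ n f G → ValAtLeast n f → ∀ i j → i < n → (embed f *₂ G) i j ≡ 0ℚ
embed-*₂-val n f G v-f i j i<n = begin
  (embed f *₂ G) i j      ≡⟨ embed-*₂-local f P₁.𝟘 G i j (λ a a≤i → v-f a (ℕₚ.≤-<-trans a≤i i<n)) ⟩
  (embed P₁.𝟘 *₂ G) i j   ≡⟨ *₂-≋ {embed P₁.𝟘} {𝟘} {G} {G} embed-𝟘 R₂.refl i j ⟩
  (𝟘 ⊛ G) i j             ≡⟨ R₂.zeroˡ G i j ⟩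
  0ℚ                      ∎
  where open ≡.≡-Reasoning

hasSum₁-stable : ∀ (F : ℕ → PS) → (∀ n → ValAtLeast n (F n)) →
                 HasSum₁ F (λ i → sumTo i (λ n → F n i))
hasSum₁-stable F v-F d = d , λ M d≤M i i<d →
  sumTo-truncate i M _ (ℕₚ.≤-trans (ℕₚ.<⇒≤ i<d) d≤M) (λ n i<n → v-F n i i<n)

hasSum₂-stable : ∀ (F : ℕ → PS2) → (∀ n i j → i < n → F n i j ≡ 0ℚ) →
                 HasSum₂ F (λ i j → sumTo i (λ n → F n i j))
hasSum₂-stable F F≡0 d = d , λ M d≤M i j i+j<d →
  sumTo-truncate i M _ (ℕₚ.≤-trans (ℕₚ.m+n≤o⇒m≤o i (ℕₚ.<⇒≤ i+j<d)) d≤M) (λ n i<n → F≡0 n i j i<n)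

module Expansion (c : ℕ → PS) (v-c : ∀ n → ValAtLeast n (c n)) where

  innerTerm : ℕ → ℕ → PS
  innerTerm m n = c (suc n) *ₚ aZ (suc m) n

  inner : ℕ → PS
  inner m i = sumTo i (λ n → innerTerm m n i)

  BTerm WTerm : ℕ → PS2
  BTerm n = embed (c n) *₂ B n
  WTerm m = embed (inner m) *₂ pow₂ w (suc m)

  S T : PS2
  S i j = sumTo i (λ n → BTerm n i j)
  T i j = sumTo i (λ m → WTerm m i j)

  innerTerm-val : ∀ m n → ValAtLeast n (innerTerm m n)
  innerTerm-val m n =
    *ₚ-val n (c (suc n)) (aZ (suc m) n) (λ i i<n → v-c (suc n) i (ℕₚ.m<n⇒m<1+n i<n))

  BTerm-vanishes : ∀ n i j → i < n → BTerm n i j ≡ 0ℚ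
  BTerm-vanishes n = embed-*₂-val n (c n) (B n) (v-c n)

  -- v(inner m) ≥ m, since a_{z₁^{m+1}}(n) = 0 for n < m
  inner-val : ∀ m → ValAtLeast m (inner m)
  inner-val m i i<m =
    ≡.trans (≡.sym (∑-sumTo i _)) (∑ℚ.∑-zero i _ (λ n n≤i → term-vanishes n (ℕₚ.≤-<-trans n≤i i<m)))
    where
    term-vanishes : ∀ n → n < m → innerTerm m n i ≡ 0ℚ
    term-vanishes n n<m = begin
      (c (suc n) *ₚ aZ (suc m) n) i  ≡⟨ ≡.cong (λ a → (c (suc n) *ₚ a) i) (aZ-vanish m n n<m) ⟩
      (c (suc n) *ₚ P₁.𝟘) i          ≡⟨ *ₚ-⊛ (c (suc n)) P₁.𝟘 i ⟩
      (c (suc n) P₁.⊛ P₁.𝟘) i        ≡⟨ R₁.zeroʳ (c (suc n)) i ⟩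
      0ℚ                             ∎
      where open ≡.≡-Reasoning

  WTerm-vanishes : ∀ m i j → i < m → WTerm m i j ≡ 0ℚ
  WTerm-vanishes m = embed-*₂-val m (inner m) (pow₂ w (suc m)) (inner-val m)

  partialInner-inner : ∀ i m a → a ≤ i → partialInner c i m a ≡ inner m a
  partialInner-inner i m a a≤i = begin
    partialInner c i m a
      ≡⟨ P₁.∑ₛ-coeff i _ a ⟩
    ∑ℚ.∑ i (λ n → (c (suc n) P₁.⊛ aZ (suc m) n) a)
      ≡⟨ ∑ℚ.∑-cong i (λ n _ → ≡.sym (*ₚ-⊛ (c (suc n)) (aZ (suc m) n) a)) ⟩
    ∑ℚ.∑ i (λ n → innerTerm m n a)
      ≡⟨ ∑-sumTo i _ ⟩
    sumTo i (λ n → innerTerm m n a)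
      ≡⟨ sumTo-truncate a i _ a≤i (λ n a<n → innerTerm-val m n a a<n) ⟩
    inner m a ∎
    where open ≡.≡-Reasoning

  -- the coefficient of qⁱ zʲ of the identity is the truncated identity at M = i
  expansion : ∀ i j → S i j ≡ (embed (c 0) +₂ T) i j
  expansion i j = begin
    sumTo i (λ n → BTerm n i j)
      ≡⟨ sumTo-truncate i (suc i) _ (ℕₚ.n≤1+n i) (λ n i<n → BTerm-vanishes n i j i<n) ⟨
    sumTo (suc i) (λ n → BTerm n i j)
      ≡⟨ sumTo-cong (suc i) _ _ (λ n _ → *₂-≋ {embed (c n)} R₂.refl (B-Bᵣ n) i j) ⟩
    sumTo (suc i) (λ n → (embed (c n) ⊛ Bᵣ n) i j)
      ≡⟨ ∑₂-coeff (suc i) _ i j ⟨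
    P₂.∑ₛ.∑ (suc i) (λ n → embed (c n) ⊛ Bᵣ n) i j
      ≡⟨ truncated-identity c i i j ⟩
    embed (c 0) i j ℚ+ P₂.∑ₛ.∑ i (λ m → embed (partialInner c i m) ⊛ W^ (suc m)) i j
      ≡⟨ ≡.cong (embed (c 0) i j ℚ+_) (∑₂-coeff i _ i j) ⟩
    embed (c 0) i j ℚ+ sumTo i (λ m → (embed (partialInner c i m) ⊛ W^ (suc m)) i j)
      ≡⟨ ≡.cong (embed (c 0) i j ℚ+_) (sumTo-cong i _ _ (λ m _ → W-summand m)) ⟩
    embed (c 0) i j ℚ+ T i j ∎
    where
    open ≡.≡-Reasoning
    W-summand : ∀ m → (embed (partialInner c i m) ⊛ W^ (suc m)) i j ≡ WTerm m i j
    W-summand m = begin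
      (embed (partialInner c i m) ⊛ W^ (suc m)) i j
        ≡⟨ *₂-≋ {embed (partialInner c i m)} R₂.refl (pow-W^ (suc m)) i j ⟨
      (embed (partialInner c i m) *₂ pow₂ w (suc m)) i j
        ≡⟨ embed-*₂-local _ (inner m) (pow₂ w (suc m)) i j (partialInner-inner i m) ⟩
      WTerm m i j ∎

proposition3p3 : (c : ℕ → PS) → (∀ n i → i < n → c n i ≡ 0ℚ) →
    Σ[ inner ∈ (ℕ → PS) ] Σ[ S ∈ PS2 ] Σ[ T ∈ PS2 ]
      (((m : ℕ) → HasSum₁ (λ n → c (suc n) *ₚ aZ (suc m) n) (inner m))
      × HasSum₂ (λ n → embed (c n) *₂ B n) S
      × HasSum₂ (λ m → embed (inner m) *₂ pow₂ w (suc m)) T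
      × (∀ i j → S i j ≡ (embed (c 0) +₂ T) i j))
proposition3p3 c v-c =
    inner , S , T
  , (λ m → hasSum₁-stable (innerTerm m) (innerTerm-val m))
  , hasSum₂-stable BTerm BTerm-vanishes
  , hasSum₂-stable WTerm WTerm-vanishes
  , expansion
  where open Expansion c v-c
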